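{- For all integers $n\geq 0$ and $k\geq 1$, \begin{align*} \overline{R_{3k}^\ast}(3n+1)&\equiv 0 \pmod{2},\\ \overline{R_{3k}^\ast}(3n+2)&\equiv 0 \pmod{4}. \end{align*}
   Context: An overpartition of $n$ is a partition of $n$ in which the first occurrence of each part size may optionally be overlined. For a positive integer $\ell$, $\overline{R_\ell^\ast}(n)$ denotes the number of overpartitions of $n$ in which no non-overlined part is divisible by $\ell$. Equivalently, with $f_k:=\prod_{i\geq 1}(1-q^{ki})$, one has $\sum_{n\geq 0}\overline{R_\ell^\ast}(n)q^n = \frac{f_2 f_\ell}{f_1^2}$. -}

module Defs where

open import Data.Nat using (ℕ; zero; suc; _+_; _*_; _∸_)
open import Data.Nat.DivMod using (_/_; _%_)
open import Data.Nat.Divisibility using (_∣?_)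
open import Data.Bool using (Bool; true; false; if_then_else_)
open import Data.Nat using (_≡ᵇ_)
open import Relation.Nullary using (does)

-- Number of ways to use parts of size p (first occurrence optionally
-- overlined, overlined copy at most once) with total weight u, such that
-- no non-overlined part of size p occurs when ℓ ∣ p.
-- Such a choice is (b , m) with b ∈ {0,1} (overlined copy present or not),
-- m ≥ 0 non-overlined copies, p * (b + m) ≡ u, and m ≡ 0 whenever ℓ ∣ p.
ways : (ℓ p : ℕ) → ℕ → ℕ
ways ℓ zero u = 0
ways ℓ (suc q) u with u ≡ᵇ 0
... | true = 1
... | false with (u % suc q) ≡ᵇ 0
...   | false = 0
...   | true with does (ℓ ∣? suc q)
...     | false = 2
...     | true = if (u / suc q) ≡ᵇ 1 then 1 else 0

sumTo : ℕ → (ℕ → ℕ) → ℕ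
sumTo zero f = f 0
sumTo (suc r) f = sumTo r f + f (suc r)

-- count ℓ s r : number of overpartitions of r with all parts in {1,…,s}
-- and no non-overlined part divisible by ℓ.
count : (ℓ s r : ℕ) → ℕ
count ℓ zero r = if r ≡ᵇ 0 then 1 else 0
count ℓ (suc s) r = sumTo r (λ u → ways ℓ (suc s) u * count ℓ s (r ∸ u))

-- R̄*_ℓ(n): number of overpartitions of n in which no non-overlined part
-- is divisible by ℓ (all parts of an overpartition of n are ≤ n).
Rbar* : ℕ → ℕ → ℕ
Rbar* ℓ n = count ℓ n n

-- The generating function is ∏_{ℓ ∤ p} (1 + q^p)/(1 − q^p) · ∏_{ℓ ∣ p} (1 + q^p). Since
-- (1 + q^p)/(1 − q^p) = 1 + 2 q^p/(1 − q^p), modulo 4 the first product is 1 + 2 E, where the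
-- u-th coefficient of E = Σ_{ℓ ∤ p} q^p/(1 − q^p) counts the divisors of u not divisible by ℓ.
-- When 3 ∣ ℓ the second product H is supported on multiples of 3, so at N ≢ 0 (mod 3) the
-- coefficient is 2 (E H)(N) modulo 4. If N ≡ 2 (mod 3), only coefficients E(u) with
-- u ≡ 2 (mod 3) enter (E H)(N); such u has no divisor divisible by ℓ and is not a square,
-- so its number of divisors is even.

module Submission where

open import Defs
open import Data.Nat using (ℕ; zero; suc; _+_; _*_; _∸_; _≤_; _<_; _≥_; z≤n; s≤s; _≡ᵇ_; _≤?_; NonZero)
open import Data.Nat.Properties
open import Data.Nat.DivMod using (_%_; _/_; m*[n/m]≡n; n/n≡1; m%n<n; %-distribˡ-*; [m+kn]%n≡m%n)
open import Data.Nat.Divisibility using (_∣_; _∣?_; divides; ∣-refl; ∣-trans; _∣0; ∣⇒≤; m∣m*n; ∣m⇒∣m*n; *-monoʳ-∣; ∣1⇒≡1; ∣m+n∣m⇒∣n; ∣m∣n⇒∣m+n; n∣m⇒m%n≡0)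
open import Algebra.Properties.CommutativeSemigroup +-commutativeSemigroup
  using () renaming (interchange to +-interchange)
open import Algebra.Properties.CommutativeSemigroup *-commutativeSemigroup
  using () renaming (x∙yz≈y∙xz to *-left-comm)
open import Data.Bool using (Bool; true; false; if_then_else_)
open import Data.Nat.Tactic.RingSolver using (solve-∀)
open import Data.Empty using (⊥-elim)
open import Data.Product using (_×_; _,_)
open import Function using (_∘_)
open import Relation.Nullary using (¬_; does; yes; no)
open import Relation.Nullary.Decidable using (dec-true; dec-false)
open import Relation.Binary.PropositionalEquality

χ : Bool → ℕ
χ b = if b then 1 else 0

≡⇒≡ᵇ-true : ∀ {m n} → m ≡ n → (m ≡ᵇ n) ≡ true
≡⇒≡ᵇ-true {m} {n} = dec-true (m ≟ n)

≢⇒≡ᵇ-false : ∀ {m n} → m ≢ n → (m ≡ᵇ n) ≡ false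
≢⇒≡ᵇ-false {m} {n} = dec-false (m ≟ n)

sumTo-cong : ∀ N {f g : ℕ → ℕ} → (∀ u → u ≤ N → f u ≡ g u) → sumTo N f ≡ sumTo N g
sumTo-cong zero    f≡g = f≡g 0 z≤n
sumTo-cong (suc N) f≡g =
  cong₂ _+_ (sumTo-cong N (λ u u≤N → f≡g u (m≤n⇒m≤1+n u≤N))) (f≡g (suc N) ≤-refl)

sumTo-+ : ∀ N f g → sumTo N (λ u → f u + g u) ≡ sumTo N f + sumTo N g
sumTo-+ zero    f g = refl
sumTo-+ (suc N) f g rewrite sumTo-+ N f g =
  +-interchange (sumTo N f) (sumTo N g) (f (suc N)) (g (suc N))

sumTo-*ˡ : ∀ N k f → sumTo N (λ u → k * f u) ≡ k * sumTo N f
sumTo-*ˡ zero    k f = refl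
sumTo-*ˡ (suc N) k f rewrite sumTo-*ˡ N k f = sym (*-distribˡ-+ k _ _)

sumTo-zero : ∀ N f → (∀ u → u ≤ N → f u ≡ 0) → sumTo N f ≡ 0
sumTo-zero zero    f f≡0 = f≡0 0 z≤n
sumTo-zero (suc N) f f≡0 =
  cong₂ _+_ (sumTo-zero N f (λ u u≤N → f≡0 u (m≤n⇒m≤1+n u≤N))) (f≡0 (suc N) ≤-refl)

sumTo-single : ∀ {N p} f → p ≤ N → (∀ u → u ≢ p → f u ≡ 0) → sumTo N f ≡ f p
sumTo-single {zero}  f z≤n _ = refl
sumTo-single {suc N} {p} f p≤1+N f≡0 with p ≟ suc N
... | yes refl = cong (_+ f (suc N)) (sumTo-zero N f (λ u u≤N → f≡0 u (<⇒≢ (s≤s u≤N))))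
... | no p≢1+N = trans
  (cong₂ _+_ (sumTo-single f (≤-pred (≤∧≢⇒< p≤1+N p≢1+N)) f≡0) (f≡0 (suc N) (p≢1+N ∘ sym)))
  (+-identityʳ (f p))

sumTo-truncate : ∀ {M N} f → M ≤ N → (∀ u → M < u → u ≤ N → f u ≡ 0) → sumTo N f ≡ sumTo M f
sumTo-truncate {M} {zero}  f z≤n _ = refl
sumTo-truncate {M} {suc N} f M≤1+N f≡0 with M ≟ suc N
... | yes refl = refl
... | no M≢1+N = trans
  (cong₂ _+_ (sumTo-truncate f M≤N (λ u M<u u≤N → f≡0 u M<u (m≤n⇒m≤1+n u≤N))) (f≡0 (suc N) (s≤s M≤N) ≤-refl))
  (+-identityʳ _)
  where M≤N = ≤-pred (≤∧≢⇒< M≤1+N M≢1+N)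

∣-sumTo : ∀ {d} N f → (∀ u → u ≤ N → d ∣ f u) → d ∣ sumTo N f
∣-sumTo zero    f d∣f = d∣f 0 z≤n
∣-sumTo (suc N) f d∣f =
  ∣m∣n⇒∣m+n (∣-sumTo N f (λ u u≤N → d∣f u (m≤n⇒m≤1+n u≤N))) (d∣f (suc N) ≤-refl)

Series : Set
Series = ℕ → ℕ

infixl 7 _·_ _⋆_
infixl 6 _⊕_

_⊕_ : Series → Series → Series
(a ⊕ b) u = a u + b u

_·_ : ℕ → Series → Series
(k · a) u = k * a u

_⋆_ : Series → Series → Series
(a ⋆ b) N = sumTo N (λ u → a u * b (N ∸ u))

δ : Series
δ zero    = 1
δ (suc _) = 0

monomial : ℕ → Series
monomial p u = χ (u ≡ᵇ p)

shift : ℕ → Series → Series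
shift p a N with p ≤? N
... | yes _ = a (N ∸ p)
... | no  _ = 0

⋆-congˡ : ∀ {a a′} b → a ≗ a′ → a ⋆ b ≗ a′ ⋆ b
⋆-congˡ b a≗a′ N = sumTo-cong N (λ u _ → cong (_* b (N ∸ u)) (a≗a′ u))

⋆-congʳ : ∀ a {b b′} → b ≗ b′ → a ⋆ b ≗ a ⋆ b′
⋆-congʳ a b≗b′ N = sumTo-cong N (λ u _ → cong (a u *_) (b≗b′ (N ∸ u)))

⋆-distribʳ-⊕ : ∀ a a′ b → (a ⊕ a′) ⋆ b ≗ a ⋆ b ⊕ a′ ⋆ b
⋆-distribʳ-⊕ a a′ b N =
  trans (sumTo-cong N (λ u _ → *-distribʳ-+ (b (N ∸ u)) (a u) (a′ u))) (sumTo-+ N _ _)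

⋆-distribˡ-⊕ : ∀ a b b′ → a ⋆ (b ⊕ b′) ≗ a ⋆ b ⊕ a ⋆ b′
⋆-distribˡ-⊕ a b b′ N =
  trans (sumTo-cong N (λ u _ → *-distribˡ-+ (a u) (b (N ∸ u)) (b′ (N ∸ u)))) (sumTo-+ N _ _)

·-⋆-assoc : ∀ k a b → (k · a) ⋆ b ≗ k · (a ⋆ b)
·-⋆-assoc k a b N =
  trans (sumTo-cong N (λ u _ → *-assoc k (a u) (b (N ∸ u)))) (sumTo-*ˡ N k _)

⋆-·-comm : ∀ k a b → a ⋆ (k · b) ≗ k · (a ⋆ b)
⋆-·-comm k a b N =
  trans (sumTo-cong N (λ u _ → *-left-comm (a u) k (b (N ∸ u)))) (sumTo-*ˡ N k _)

⋆-identityˡ : ∀ b → δ ⋆ b ≗ b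
⋆-identityˡ b N = trans (sumTo-single {N} _ z≤n δu≡0) (+-identityʳ (b N))
  where
  δu≡0 : ∀ u → u ≢ 0 → δ u * b (N ∸ u) ≡ 0
  δu≡0 zero    0≢0 = ⊥-elim (0≢0 refl)
  δu≡0 (suc u) _   = refl

monomial-⋆ : ∀ p b → monomial p ⋆ b ≗ shift p b
monomial-⋆ p b N with p ≤? N
... | yes p≤N = begin
  sumTo N (λ u → monomial p u * b (N ∸ u)) ≡⟨ sumTo-single _ p≤N off-p ⟩
  χ (p ≡ᵇ p) * b (N ∸ p)                   ≡⟨ cong (λ t → χ t * b (N ∸ p)) (≡⇒≡ᵇ-true {p} refl) ⟩
  1 * b (N ∸ p)                            ≡⟨ *-identityˡ _ ⟩
  b (N ∸ p)                                ∎
  where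
  open ≡-Reasoning
  off-p : ∀ u → u ≢ p → monomial p u * b (N ∸ u) ≡ 0
  off-p u u≢p rewrite ≢⇒≡ᵇ-false u≢p = refl
... | no p≰N = sumTo-zero N _ (λ u u≤N → cong (λ t → χ t * b (N ∸ u)) (≢⇒≡ᵇ-false {u} (u≢p u≤N)))
  where
  u≢p : ∀ {u} → u ≤ N → u ≢ p
  u≢p u≤N refl = p≰N u≤N

shift-cong : ∀ p {a b} → a ≗ b → shift p a ≗ shift p b
shift-cong p a≗b N with p ≤? N
... | yes _ = a≗b (N ∸ p)
... | no  _ = refl

shift-≤ : ∀ p {N} a → p ≤ N → shift p a N ≡ a (N ∸ p)
shift-≤ p {N} a p≤N with p ≤? N
... | yes _   = refl
... | no p≰N = ⊥-elim (p≰N p≤N)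

shift-≰ : ∀ p {N} a → ¬ p ≤ N → shift p a N ≡ 0
shift-≰ p {N} a p≰N with p ≤? N
... | yes p≤N = ⊥-elim (p≰N p≤N)
... | no _    = refl

∸-≤-swap : ∀ {m n o} → n ≤ o → m ≤ o ∸ n → n ≤ o ∸ m
∸-≤-swap {m} {n} {o} n≤o m≤o∸n = m+n≤o⇒m≤o∸n n (subst (_≤ o) (+-comm m n) (m≤o∸n⇒m+n≤o m n≤o m≤o∸n))

∸-swap : ∀ m n o → m ∸ n ∸ o ≡ m ∸ o ∸ n
∸-swap m n o = trans (∸-+-assoc m n o) (trans (cong (m ∸_) (+-comm n o)) (sym (∸-+-assoc m o n)))

shift-⋆ : ∀ p a b → shift p (a ⋆ b) ≗ a ⋆ shift p b
shift-⋆ p a b N with p ≤? N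
... | no p≰N = sym (sumTo-zero N _ vanish)
  where
  vanish : ∀ u → u ≤ N → a u * shift p b (N ∸ u) ≡ 0
  vanish u _ = trans (cong (a u *_) (shift-≰ p b (p≰N ∘ λ p≤N∸u → ≤-trans p≤N∸u (m∸n≤m N u)))) (*-zeroʳ (a u))
... | yes p≤N = begin
  sumTo (N ∸ p) (λ u → a u * b (N ∸ p ∸ u))      ≡⟨ sumTo-cong (N ∸ p) inside ⟩
  sumTo (N ∸ p) (λ u → a u * shift p b (N ∸ u))  ≡⟨ sumTo-truncate _ (m∸n≤m N p) outside ⟨
  sumTo N (λ u → a u * shift p b (N ∸ u))        ∎
  where
  open ≡-Reasoning
  inside : ∀ u → u ≤ N ∸ p → a u * b (N ∸ p ∸ u) ≡ a u * shift p b (N ∸ u)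
  inside u u≤N∸p = cong (a u *_) (trans (cong b (∸-swap N p u)) (sym (shift-≤ p b (∸-≤-swap p≤N u≤N∸p))))
  outside : ∀ u → N ∸ p < u → u ≤ N → a u * shift p b (N ∸ u) ≡ 0
  outside u N∸p<u u≤N = trans (cong (a u *_) (shift-≰ p b (<⇒≱ N∸p<u ∘ ∸-≤-swap u≤N))) (*-zeroʳ (a u))

multiplesOf : ℕ → Series
multiplesOf p zero    = 0
multiplesOf p (suc u) = χ (does (p ∣? suc u))

multiplesOf-∤ : ∀ {p u} → ¬ p ∣ u → multiplesOf p u ≡ 0
multiplesOf-∤ {p} {zero}  _   = refl
multiplesOf-∤ {p} {suc u} p∤u = cong χ (dec-false (p ∣? suc u) p∤u)

/≡1⇒≡ : ∀ {m n} .{{_ : NonZero m}} → m ∣ n → n / m ≡ 1 → n ≡ m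
/≡1⇒≡ {m} {n} m∣n n/m≡1 = trans (sym (m*[n/m]≡n m∣n)) (trans (cong (m *_) n/m≡1) (*-identityʳ m))

ways-∤ : ∀ ℓ q → ¬ ℓ ∣ suc q → ways ℓ (suc q) ≗ δ ⊕ 2 · multiplesOf (suc q)
ways-∤ ℓ q ℓ∤ zero = refl
ways-∤ ℓ q ℓ∤ (suc v) with suc v % suc q ≡ᵇ 0
... | false = refl
... | true rewrite dec-false (ℓ ∣? suc q) ℓ∤ = refl

ways-∣ : ∀ ℓ q → ℓ ∣ suc q → ways ℓ (suc q) ≗ δ ⊕ monomial (suc q)
ways-∣ ℓ q ℓ∣ zero = refl
ways-∣ ℓ q ℓ∣ (suc v) with suc q ∣? suc v | v ≟ q
... | no q∤  | yes refl = ⊥-elim (q∤ ∣-refl)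
... | no q∤  | no v≢q   rewrite dec-false (suc q ∣? suc v) q∤ | ≢⇒≡ᵇ-false v≢q = refl
... | yes q∣ | yes refl rewrite dec-true (suc v ∣? suc v) q∣ | dec-true (ℓ ∣? suc v) ℓ∣
                              | n/n≡1 (suc v) ⦃ _ ⦄ | ≡⇒≡ᵇ-true {v} refl = refl
... | yes q∣ | no v≢q   rewrite dec-true (suc q ∣? suc v) q∣ | dec-true (ℓ ∣? suc q) ℓ∣
                              | ≢⇒≡ᵇ-false (v≢q ∘ suc-injective ∘ /≡1⇒≡ q∣) | ≢⇒≡ᵇ-false v≢q = refl

divisorCount : ℕ → Series
divisorCount s u = sumTo s (λ p → multiplesOf p u)

divisorCountAvoiding : ℕ → ℕ → Series
divisorCountAvoiding ℓ s u = sumTo s (λ p → if does (ℓ ∣? p) then 0 else multiplesOf p u)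

divisorCountAvoiding-zero : ∀ ℓ u → divisorCountAvoiding ℓ 0 u ≡ 0
divisorCountAvoiding-zero ℓ u rewrite dec-true (ℓ ∣? 0) (ℓ ∣0) = refl

divisorCountAvoiding-suc-∤ : ∀ ℓ s → ¬ ℓ ∣ suc s →
  divisorCountAvoiding ℓ (suc s) ≗ divisorCountAvoiding ℓ s ⊕ multiplesOf (suc s)
divisorCountAvoiding-suc-∤ ℓ s ℓ∤ u rewrite dec-false (ℓ ∣? suc s) ℓ∤ = refl

divisorCountAvoiding-suc-∣ : ∀ ℓ s → ℓ ∣ suc s →
  divisorCountAvoiding ℓ (suc s) ≗ divisorCountAvoiding ℓ s
divisorCountAvoiding-suc-∣ ℓ s ℓ∣ u rewrite dec-true (ℓ ∣? suc s) ℓ∣ = +-identityʳ _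

SupportedOnMultiplesOf : ℕ → Series → Set
SupportedOnMultiplesOf d a = ∀ u → ¬ d ∣ u → a u ≡ 0

δ-supported : ∀ d → SupportedOnMultiplesOf d δ
δ-supported d zero    d∤0 = ⊥-elim (d∤0 (d ∣0))
δ-supported d (suc u) _   = refl

shift-supported : ∀ {d p a} → d ∣ p → SupportedOnMultiplesOf d a → SupportedOnMultiplesOf d (shift p a)
shift-supported {d} {p} {a} d∣p a-supp u d∤u with p ≤? u
... | yes p≤u = a-supp (u ∸ p) (λ d∣u∸p → d∤u (subst (d ∣_) (m∸n+n≡m p≤u) (∣m∣n⇒∣m+n d∣u∸p d∣p)))
... | no  _   = refl

⋆-distribˡ-h+2z+4r : ∀ a h z r → a ⋆ (h ⊕ 2 · z ⊕ 4 · r) ≗ a ⋆ h ⊕ 2 · (a ⋆ z) ⊕ 4 · (a ⋆ r)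
⋆-distribˡ-h+2z+4r a h z r N = begin
  (a ⋆ (h ⊕ 2 · z ⊕ 4 · r)) N               ≡⟨ ⋆-distribˡ-⊕ a (h ⊕ 2 · z) (4 · r) N ⟩
  (a ⋆ (h ⊕ 2 · z)) N + (a ⋆ (4 · r)) N     ≡⟨ cong₂ _+_ (⋆-distribˡ-⊕ a h (2 · z) N) (⋆-·-comm 4 a r N) ⟩
  (a ⋆ h) N + (a ⋆ (2 · z)) N + 4 * (a ⋆ r) N ≡⟨ cong (λ t → (a ⋆ h) N + t + 4 * (a ⋆ r) N) (⋆-·-comm 2 a z N) ⟩
  (a ⋆ h) N + 2 * (a ⋆ z) N + 4 * (a ⋆ r) N ∎
  where open ≡-Reasoning

shift-distrib-h+2z+4r : ∀ p h z r → shift p (h ⊕ 2 · z ⊕ 4 · r) ≗ shift p h ⊕ 2 · shift p z ⊕ 4 · shift p r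
shift-distrib-h+2z+4r p h z r N with p ≤? N
... | yes _ = refl
... | no  _ = refl

-- count ℓ s ≡ H · (1 + 2 E) (mod 4) for E = divisorCountAvoiding ℓ s; the H constructed
-- below is ∏_{p ≤ s, ℓ ∣ p} (1 + q^p).
record Mod4Decomposition (d ℓ s : ℕ) : Set where
  field
    H R         : Series
    H-supported : SupportedOnMultiplesOf d H
    count≗      : count ℓ s ≗ H ⊕ 2 · (divisorCountAvoiding ℓ s ⋆ H) ⊕ 4 · R

mod4Decomposition-zero : ∀ d ℓ → Mod4Decomposition d ℓ 0
mod4Decomposition-zero d ℓ = record
  { H = δ ; R = λ _ → 0 ; H-supported = δ-supported d ; count≗ = count₀≗ }
  where
  count₀≗ : count ℓ 0 ≗ δ ⊕ 2 · (divisorCountAvoiding ℓ 0 ⋆ δ) ⊕ 4 · (λ _ → 0)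
  count₀≗ N rewrite sumTo-zero N _ (λ u _ → cong (_* δ (N ∸ u)) (divisorCountAvoiding-zero ℓ u)) with N
  ... | zero  = refl
  ... | suc _ = refl

module _ {d ℓ s : ℕ} (D : Mod4Decomposition d ℓ s) where
  open Mod4Decomposition D

  private
    c = count ℓ s
    E = divisorCountAvoiding ℓ s
    Z = E ⋆ H

  mod4Decomposition-suc-∤ : ¬ ℓ ∣ suc s → Mod4Decomposition d ℓ (suc s)
  mod4Decomposition-suc-∤ ℓ∤ = record
    { H = H ; R = R′ ; H-supported = H-supported ; count≗ = count′≗ }
    where
    M  = multiplesOf (suc s)
    R′ = R ⊕ M ⋆ Z ⊕ 2 · (M ⋆ R)
    regroup : ∀ h z r a b e → h + 2 * z + 4 * r + 2 * (a + 2 * b + 4 * e) ≡ h + 2 * (z + a) + 4 * (r + b + 2 * e)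
    regroup = solve-∀
    count′≗ : count ℓ (suc s) ≗ H ⊕ 2 · (divisorCountAvoiding ℓ (suc s) ⋆ H) ⊕ 4 · R′
    count′≗ N = begin
      (ways ℓ (suc s) ⋆ c) N                   ≡⟨ ⋆-congˡ c (ways-∤ ℓ s ℓ∤) N ⟩
      ((δ ⊕ 2 · M) ⋆ c) N                      ≡⟨ ⋆-distribʳ-⊕ δ (2 · M) c N ⟩
      (δ ⋆ c) N + ((2 · M) ⋆ c) N              ≡⟨ cong₂ _+_ (⋆-identityˡ c N) (·-⋆-assoc 2 M c N) ⟩
      c N + 2 * (M ⋆ c) N                      ≡⟨ cong₂ (λ x y → x + 2 * y) (count≗ N)
                                                   (trans (⋆-congʳ M count≗ N) (⋆-distribˡ-h+2z+4r M H Z R N)) ⟩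
      H N + 2 * Z N + 4 * R N + 2 * ((M ⋆ H) N + 2 * (M ⋆ Z) N + 4 * (M ⋆ R) N)
                                               ≡⟨ regroup (H N) (Z N) (R N) ((M ⋆ H) N) ((M ⋆ Z) N) ((M ⋆ R) N) ⟩
      H N + 2 * (Z N + (M ⋆ H) N) + 4 * R′ N   ≡⟨ cong (λ t → H N + 2 * t + 4 * R′ N) E′⋆H ⟨
      H N + 2 * (divisorCountAvoiding ℓ (suc s) ⋆ H) N + 4 * R′ N ∎
      where
      open ≡-Reasoning
      E′⋆H : (divisorCountAvoiding ℓ (suc s) ⋆ H) N ≡ Z N + (M ⋆ H) N
      E′⋆H = trans (⋆-congˡ H (divisorCountAvoiding-suc-∤ ℓ s ℓ∤) N) (⋆-distribʳ-⊕ E M H N)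

  mod4Decomposition-suc-∣ : d ∣ ℓ → ℓ ∣ suc s → Mod4Decomposition d ℓ (suc s)
  mod4Decomposition-suc-∣ d∣ℓ ℓ∣ = record
    { H = H′ ; R = R′ ; H-supported = H′-supported ; count≗ = count′≗ }
    where
    p  = suc s
    H′ = H ⊕ shift p H
    R′ = R ⊕ shift p R
    H′-supported : SupportedOnMultiplesOf d H′
    H′-supported u d∤u = cong₂ _+_ (H-supported u d∤u) (shift-supported (∣-trans d∣ℓ ℓ∣) H-supported u d∤u)
    regroup : ∀ h z r h′ z′ r′ → h + 2 * z + 4 * r + (h′ + 2 * z′ + 4 * r′) ≡ (h + h′) + 2 * (z + z′) + 4 * (r + r′)
    regroup = solve-∀
    count′≗ : count ℓ (suc s) ≗ H′ ⊕ 2 · (divisorCountAvoiding ℓ (suc s) ⋆ H′) ⊕ 4 · R′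
    count′≗ N = begin
      (ways ℓ p ⋆ c) N                         ≡⟨ ⋆-congˡ c (ways-∣ ℓ s ℓ∣) N ⟩
      ((δ ⊕ monomial p) ⋆ c) N                 ≡⟨ ⋆-distribʳ-⊕ δ (monomial p) c N ⟩
      (δ ⋆ c) N + (monomial p ⋆ c) N           ≡⟨ cong₂ _+_ (⋆-identityˡ c N) (monomial-⋆ p c N) ⟩
      c N + shift p c N                        ≡⟨ cong₂ _+_ (count≗ N)
                                                   (trans (shift-cong p count≗ N) (shift-distrib-h+2z+4r p H Z R N)) ⟩
      H N + 2 * Z N + 4 * R N + (shift p H N + 2 * shift p Z N + 4 * shift p R N)
                                               ≡⟨ regroup (H N) (Z N) (R N) (shift p H N) (shift p Z N) (shift p R N) ⟩
      H′ N + 2 * (Z N + shift p Z N) + 4 * R′ N ≡⟨ cong (λ t → H′ N + 2 * t + 4 * R′ N) E′⋆H′ ⟨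
      H′ N + 2 * (divisorCountAvoiding ℓ p ⋆ H′) N + 4 * R′ N ∎
      where
      open ≡-Reasoning
      E′⋆H′ : (divisorCountAvoiding ℓ p ⋆ H′) N ≡ Z N + shift p Z N
      E′⋆H′ = begin
        (divisorCountAvoiding ℓ p ⋆ H′) N  ≡⟨ ⋆-congˡ H′ (divisorCountAvoiding-suc-∣ ℓ s ℓ∣) N ⟩
        (E ⋆ H′) N                          ≡⟨ ⋆-distribˡ-⊕ E H (shift p H) N ⟩
        Z N + (E ⋆ shift p H) N             ≡⟨ cong (Z N +_) (shift-⋆ p E H N) ⟨
        Z N + shift p Z N                   ∎

mod4Decomposition : ∀ {d ℓ} → d ∣ ℓ → ∀ s → Mod4Decomposition d ℓ s
mod4Decomposition {d} {ℓ} d∣ℓ zero = mod4Decomposition-zero d ℓ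
mod4Decomposition {d} {ℓ} d∣ℓ (suc s) with ℓ ∣? suc s
... | yes ℓ∣ = mod4Decomposition-suc-∣ (mod4Decomposition d∣ℓ s) d∣ℓ ℓ∣
... | no  ℓ∤ = mod4Decomposition-suc-∤ (mod4Decomposition d∣ℓ s) ℓ∤

sumTo²-even : ∀ N (g : ℕ → ℕ → ℕ) → (∀ a b → g a b ≡ g b a) → (∀ a → g a a ≡ 0) → 2 ∣ sumTo N (λ a → sumTo N (g a))
sumTo²-even zero    g g-sym g-diag = subst (2 ∣_) (sym (g-diag 0)) (2 ∣0)
sumTo²-even (suc N) g g-sym g-diag =
  subst (2 ∣_) (sym split) (∣m∣n⇒∣m+n (sumTo²-even N g g-sym g-diag) (m∣m*n T))
  where
  S = sumTo N (λ a → sumTo N (g a))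
  T = sumTo N (g (suc N))
  split : sumTo (suc N) (λ a → sumTo (suc N) (g a)) ≡ S + 2 * T
  split = begin
    sumTo (suc N) (λ a → sumTo N (g a) + g a (suc N))
      ≡⟨ sumTo-+ (suc N) (λ a → sumTo N (g a)) (λ a → g a (suc N)) ⟩
    S + T + (sumTo N (λ a → g a (suc N)) + g (suc N) (suc N))   ≡⟨ cong₂ (λ x y → S + T + (x + y))
                                                                     (sumTo-cong N (λ a _ → g-sym a (suc N))) (g-diag (suc N)) ⟩
    S + T + (T + 0)                                             ≡⟨ regroup S T ⟩
    S + 2 * T                                                   ∎
    where
    open ≡-Reasoning
    regroup : ∀ x y → x + y + (y + 0) ≡ x + 2 * y
    regroup = solve-∀

sumTo-factorisations : ∀ a w → sumTo (suc w) (λ b → χ (a * b ≡ᵇ suc w)) ≡ multiplesOf a (suc w)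
sumTo-factorisations zero    w = sumTo-zero (suc w) _ (λ _ _ → refl)
sumTo-factorisations (suc q) w with suc q ∣? suc w
... | yes q∣@(divides c w≡cq) rewrite dec-true (suc q ∣? suc w) q∣ =
  trans (sumTo-single (λ b → χ (suc q * b ≡ᵇ suc w)) c≤w off-c) (cong χ (≡⇒≡ᵇ-true qc≡w))
  where
  qc≡w : suc q * c ≡ suc w
  qc≡w = trans (*-comm (suc q) c) (sym w≡cq)
  c≤w : c ≤ suc w
  c≤w = ∣⇒≤ (divides (suc q) (trans w≡cq (*-comm c (suc q))))
  off-c : ∀ b → b ≢ c → χ (suc q * b ≡ᵇ suc w) ≡ 0
  off-c b b≢c = cong χ (≢⇒≡ᵇ-false (b≢c ∘ λ qb≡w → *-cancelˡ-≡ b c (suc q) (trans qb≡w (sym qc≡w))))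
... | no q∤ rewrite dec-false (suc q ∣? suc w) q∤ =
  sumTo-zero (suc w) _ (λ b _ → cong χ (≢⇒≡ᵇ-false (q∤ ∘ qb≡w⇒q∣w b)))
  where
  qb≡w⇒q∣w : ∀ b → suc q * b ≡ suc w → suc q ∣ suc w
  qb≡w⇒q∣w b qb≡w = divides b (trans (sym qb≡w) (*-comm (suc q) b))

divisorCount-even : ∀ w → (∀ a → a * a ≢ suc w) → 2 ∣ divisorCount (suc w) (suc w)
divisorCount-even w non-square = subst (2 ∣_) factorise (sumTo²-even (suc w) g g-sym g-diag)
  where
  g : ℕ → ℕ → ℕ
  g a b = χ (a * b ≡ᵇ suc w)
  g-sym : ∀ a b → g a b ≡ g b a
  g-sym a b = cong (λ t → χ (t ≡ᵇ suc w)) (*-comm a b)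
  g-diag : ∀ a → g a a ≡ 0
  g-diag a = cong χ (≢⇒≡ᵇ-false (non-square a))
  factorise : sumTo (suc w) (λ a → sumTo (suc w) (g a)) ≡ divisorCount (suc w) (suc w)
  factorise = sumTo-cong (suc w) (λ a _ → sumTo-factorisations a w)

divisorCount-truncate : ∀ {s} w → suc w ≤ s → divisorCount s (suc w) ≡ divisorCount (suc w) (suc w)
divisorCount-truncate w w<s = sumTo-truncate _ w<s (λ p w<p _ → multiplesOf-∤ (<⇒≱ w<p ∘ ∣⇒≤))

divisorCountAvoiding≡divisorCount : ∀ {d ℓ} s u → d ∣ ℓ → ¬ d ∣ u →
  divisorCountAvoiding ℓ s u ≡ divisorCount s u
divisorCountAvoiding≡divisorCount {d} {ℓ} s u d∣ℓ d∤u = sumTo-cong s term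
  where
  term : ∀ p → p ≤ s → (if does (ℓ ∣? p) then 0 else multiplesOf p u) ≡ multiplesOf p u
  term p _ with ℓ ∣? p
  ... | no  _  = refl
  ... | yes ℓ∣ = sym (multiplesOf-∤ (d∤u ∘ ∣-trans (∣-trans d∣ℓ ℓ∣)))

square-%3≢2 : ∀ a → a * a % 3 ≢ 2
square-%3≢2 a a²%3≡2 = residue (a % 3) (m%n<n a 3) (trans (sym (%-distribˡ-* a a 3)) a²%3≡2)
  where
  residue : ∀ r → r < 3 → r * r % 3 ≢ 2
  residue 0 _ ()
  residue 1 _ ()
  residue 2 _ ()
  residue (suc (suc (suc _))) (s≤s (s≤s (s≤s ()))) _

%3≡2⇒3∤ : ∀ {u} → u % 3 ≡ 2 → ¬ 3 ∣ u
%3≡2⇒3∤ {u} u%3≡2 3∣u with () ← trans (sym (n∣m⇒m%n≡0 u 3 3∣u)) u%3≡2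

divisorCountAvoiding-even : ∀ {ℓ s u} → 3 ∣ ℓ → u ≤ s → u % 3 ≡ 2 → 2 ∣ divisorCountAvoiding ℓ s u
divisorCountAvoiding-even {u = zero} _ _ ()
divisorCountAvoiding-even {ℓ} {s} {suc w} 3∣ℓ w<s w%3≡2 =
  subst (2 ∣_) (sym E≡divisorCount) (divisorCount-even w non-square)
  where
  E≡divisorCount : divisorCountAvoiding ℓ s (suc w) ≡ divisorCount (suc w) (suc w)
  E≡divisorCount =
    trans (divisorCountAvoiding≡divisorCount s (suc w) 3∣ℓ (%3≡2⇒3∤ w%3≡2)) (divisorCount-truncate w w<s)
  non-square : ∀ a → a * a ≢ suc w
  non-square a a²≡w = square-%3≢2 a (trans (cong (_% 3) a²≡w) w%3≡2)

module _ {ℓ s} (D : Mod4Decomposition 3 ℓ s) where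
  open Mod4Decomposition D

  private
    Z = divisorCountAvoiding ℓ s ⋆ H

  count-at-∤3 : ∀ {N} → ¬ 3 ∣ N → count ℓ s N ≡ 2 * (Z N + 2 * R N)
  count-at-∤3 {N} 3∤N =
    trans (count≗ N) (trans (cong (λ h → h + 2 * Z N + 4 * R N) (H-supported N 3∤N)) (regroup (Z N) (R N)))
    where
    regroup : ∀ z r → 0 + 2 * z + 4 * r ≡ 2 * (z + 2 * r)
    regroup = solve-∀

  ∤3⇒2∣count : ∀ {N} → ¬ 3 ∣ N → 2 ∣ count ℓ s N
  ∤3⇒2∣count {N} 3∤N = subst (2 ∣_) (sym (count-at-∤3 3∤N)) (m∣m*n (Z N + 2 * R N))

  %3≡2⇒4∣count : ∀ {N} → 3 ∣ ℓ → N ≤ s → N % 3 ≡ 2 → 4 ∣ count ℓ s N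
  %3≡2⇒4∣count {N} 3∣ℓ N≤s N%3≡2 =
    subst (4 ∣_) (sym (count-at-∤3 (%3≡2⇒3∤ N%3≡2))) (*-monoʳ-∣ 2 (∣m∣n⇒∣m+n (∣-sumTo N _ term) (m∣m*n (R N))))
    where
    term : ∀ u → u ≤ N → 2 ∣ divisorCountAvoiding ℓ s u * H (N ∸ u)
    term u u≤N with 3 ∣? (N ∸ u)
    ... | no 3∤ rewrite H-supported (N ∸ u) 3∤ | *-zeroʳ (divisorCountAvoiding ℓ s u) = 2 ∣0
    ... | yes (divides q N∸u≡q3) = ∣m⇒∣m*n _ (divisorCountAvoiding-even 3∣ℓ (≤-trans u≤N N≤s) u%3≡2)
      where
      open ≡-Reasoning
      u%3≡2 : u % 3 ≡ 2
      u%3≡2 = begin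
        u % 3               ≡⟨ [m+kn]%n≡m%n u q 3 ⟨
        (u + q * 3) % 3     ≡⟨ cong (λ t → (u + t) % 3) N∸u≡q3 ⟨
        (u + (N ∸ u)) % 3   ≡⟨ cong (_% 3) (m+[n∸m]≡n u≤N) ⟩
        N % 3               ≡⟨ N%3≡2 ⟩
        2                   ∎

theorem1p2 : (n k : ℕ) → k ≥ 1 →
    (2 ∣ Rbar* (3 * k) (3 * n + 1)) × (4 ∣ Rbar* (3 * k) (3 * n + 2))
theorem1p2 n k _ =
  ∤3⇒2∣count (mod4Decomposition 3∣ℓ (3 * n + 1)) 3∤3n+1 ,
  %3≡2⇒4∣count (mod4Decomposition 3∣ℓ (3 * n + 2)) 3∣ℓ ≤-refl [3n+2]%3≡2
  where
  3∣ℓ : 3 ∣ 3 * k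
  3∣ℓ = m∣m*n k
  3∤3n+1 : ¬ 3 ∣ 3 * n + 1
  3∤3n+1 3∣ with () ← ∣1⇒≡1 (∣m+n∣m⇒∣n 3∣ (m∣m*n n))
  [3n+2]%3≡2 : (3 * n + 2) % 3 ≡ 2
  [3n+2]%3≡2 = trans (cong (_% 3) (trans (+-comm (3 * n) 2) (cong (2 +_) (*-comm 3 n)))) ([m+kn]%n≡m%n 2 n 3)
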